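{- Let $k\ge1$ and $r\ge 1$, and let $n=(2k-1)(3^r-1)/2$. Then $nK_2$ admits a $k$-super graceful labeling whose edge-label set is $[k,k+n-1]$.
   Context: $nK_2$ denotes the disjoint union of $n$ copies of $K_2$. For integers $a\le b$, $[a,b]$ is the set of integers between $a$ and $b$ inclusive. For $k\ge 1$, a $k$-super graceful labeling of a graph $G=(V,E)$ with $p$ vertices and $q$ edges is a bijection $f:V\cup E\to[k,k+p+q-1]$ with $f(uv)=|f(u)-f(v)|$ for every edge $uv$. -}

module Defs where

open import Data.Nat using (ℕ; _+_; _∸_; _≤_; ∣_-_∣)
open import Data.Fin using (Fin; _↑ˡ_; _↑ʳ_)
open import Data.Sum using (_⊎_; inj₁; inj₂)
open import Data.Product using (_×_; _,_; proj₁; proj₂; ∃)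
open import Relation.Binary.PropositionalEquality using (_≡_)

record Graph : Set where
  field
    p : ℕ
    q : ℕ
    ends : Fin q → Fin p × Fin p
open Graph public

-- n K_2 : vertices Fin (n + n); edge i joins vertex i and vertex n + i.
nK₂ : ℕ → Graph
nK₂ n = record { p = n + n ; q = n ; ends = λ i → i ↑ˡ n , n ↑ʳ i }

InRange : ℕ → ℕ → ℕ → Set
InRange a b x = a ≤ x × x ≤ b

record SuperGraceful (k : ℕ) (G : Graph) (f : Fin (p G) ⊎ Fin (q G) → ℕ) : Set where
  field
    injective : ∀ x y → f x ≡ f y → x ≡ y
    into      : ∀ x → InRange k (k + p G + q G ∸ 1) (f x)
    onto      : ∀ m → InRange k (k + p G + q G ∸ 1) m → ∃ λ x → f x ≡ m
    edgeLabel : ∀ e → f (inj₂ e) ≡ ∣ f (inj₁ (proj₁ (ends G e))) - f (inj₁ (proj₂ (ends G e))) ∣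

EdgeLabelSet : (G : Graph) → (Fin (p G) ⊎ Fin (q G) → ℕ) → ℕ → ℕ → Set
EdgeLabelSet G f a b = ∀ m → ((∃ λ e → f (inj₂ e) ≡ m) → InRange a b m)
                           × (InRange a b m → ∃ λ e → f (inj₂ e) ≡ m)

module Submission where

-- A Langford pairing of defect d and order n splits {0, …, 2n − 1} into n pairs with
-- differences d, d + 1, …, d + n − 1. One with d = k yields the labeling: edge i of nK₂ gets
-- k + i and its ends get k + n plus the members of pair i, so edges carry [k, k + n − 1],
-- vertices carry [k + n, k + 3n − 1], and each edge label is the difference of its end labels.
--
-- For d = e + 1 and n = (2e + 1)(3^r − 1)/2 the pairing is built by induction on r from the
-- empty pairing, using three general constructions: concatenation (defect d, order m followed
-- by defect d + m, order n gives defect d, order m + n), tripling (each position x becomes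
-- 3x, 3x + 1, 3x + 2, taking defect e + 1, order n to defect 3e + 2, order 3n) and an explicit
-- base pairing of defect e + 1 and order 2e + 1; as 3e + 2 = (e + 1) + (2e + 1), each step
-- concatenates the base pairing with the tripled previous one.

open import Defs
open import Data.Nat using (ℕ; _+_; _*_; _∸_; _^_; _≤_; _/_)
open import Data.Sum using (_⊎_)
open import Data.Fin using (Fin)
open import Data.Product using (Σ; _×_)

open import Data.Nat using (zero; suc; _<_; _%_; _<?_; _≟_; NonZero; z≤n; s≤s; s≤s⁻¹; ∣_-_∣)
open import Data.Nat.Properties
open import Data.Nat.DivMod using (m≡m%n+[m/n]*n; m%n<n; m<n⇒m%n≡m; m<n⇒m/n≡0; m*n%n≡0; m*n/n≡m; [m+kn]%n≡m%n; +-distrib-/)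
open import Data.Nat.Tactic.RingSolver using (solve-∀)
open import Data.Bool using (Bool; true; false)
open import Data.Fin using (toℕ; fromℕ<; punchOut; _↑ˡ_; _↑ʳ_; splitAt; join)
open import Data.Fin.Properties using (toℕ-fromℕ<; toℕ<n; toℕ-injective; any?; punchOut-injective; injective⇒≤; splitAt-↑ˡ; splitAt-↑ʳ; join-splitAt)
open import Data.Sum using (inj₁; inj₂)
open import Data.Product using (_,_; ∃; proj₁; proj₂)
open import Data.Product.Properties using (,-injectiveˡ; ,-injectiveʳ)
open import Function.Definitions using (Injective)
open import Relation.Binary.PropositionalEquality
open import Relation.Nullary using (yes; no; contradiction)

digit-quotient : ∀ {d r} .{{_ : NonZero d}} q → r < d → (r + q * d) / d ≡ q
digit-quotient {d} {r} q r<d = begin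
  (r + q * d) / d    ≡⟨ +-distrib-/ r (q * d) no-carry ⟩
  r / d + q * d / d  ≡⟨ cong₂ _+_ (m<n⇒m/n≡0 r<d) (m*n/n≡m q d) ⟩
  q                  ∎
  where
  open ≡-Reasoning
  no-carry : r % d + q * d % d < d
  no-carry = subst (_< d) (sym (trans (cong₂ _+_ (m<n⇒m%n≡m r<d) (m*n%n≡0 q d)) (+-identityʳ r))) r<d

digit-remainder : ∀ {d r} .{{_ : NonZero d}} q → r < d → (r + q * d) % d ≡ r
digit-remainder {d} {r} q r<d = trans ([m+kn]%n≡m%n r q d) (m<n⇒m%n≡m r<d)

digits-unique : ∀ {d r s q q′} .{{_ : NonZero d}} → r < d → s < d →
                r + q * d ≡ s + q′ * d → r ≡ s × q ≡ q′
digits-unique {d} {q = q} {q′} r<d s<d eq =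
  trans (sym (digit-remainder q r<d)) (trans (cong (_% d) eq) (digit-remainder q′ s<d)) ,
  trans (sym (digit-quotient q r<d)) (trans (cong (_/ d) eq) (digit-quotient q′ s<d))

data Digits (d : ℕ) : ℕ → Set where
  digits : ∀ r q → r < d → Digits d (r + q * d)

digitsOf : ∀ d .{{_ : NonZero d}} j → Digits d j
digitsOf d j = subst (Digits d) (sym (m≡m%n+[m/n]*n j d)) (digits (j % d) (j / d) (m%n<n j d))

digits-< : ∀ {d r q n} → r < d → q < n → r + q * d < n * d
digits-< {d} {r} {q} {n} r<d q<n = begin-strict
  r + q * d  <⟨ +-monoˡ-< (q * d) r<d ⟩
  d + q * d  ≤⟨ *-monoˡ-≤ d q<n ⟩
  n * d      ∎
  where open ≤-Reasoning

digits-<⁻¹ : ∀ {d r q n} → r + q * d < n * d → q < n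
digits-<⁻¹ {d} {r} {q} {n} lt = *-cancelʳ-< d q n (≤-<-trans (m≤n+m (q * d) r) lt)

data Cut (a b : ℕ) : ℕ → Set where
  low  : ∀ {j} → j < a → Cut a b j
  high : ∀ {t} → t < b → Cut a b (a + t)

cut : ∀ a {b j} → j < a + b → Cut a b j
cut a {b} {j} j<a+b with j <? a
... | yes j<a = low j<a
... | no j≮a = subst (Cut a b) a+t≡j (high (+-cancelˡ-< a _ _ (subst (_< a + b) (sym a+t≡j) j<a+b)))
  where
  a+t≡j : a + (j ∸ a) ≡ j
  a+t≡j = m+[n∸m]≡n (≮⇒≥ j≮a)

offset∈range : ∀ {a j N} → j < N → InRange a (a + N ∸ 1) (a + j)
offset∈range {a} {j} {N} j<N =
  m≤m+n a j , m+n≤o⇒m≤o∸n (a + j) (subst (_≤ a + N) (+-comm 1 (a + j)) (+-monoʳ-< a j<N))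

range⇒offset : ∀ {a m N} → 1 ≤ a → InRange a (a + N ∸ 1) m → ∃ λ j → j < N × a + j ≡ m
range⇒offset {a} {m} {N} 1≤a (a≤m , m≤top) = m ∸ a , +-cancelˡ-< a _ _ a+j<a+N , a+j≡m
  where
  a+j≡m : a + (m ∸ a) ≡ m
  a+j≡m = m+[n∸m]≡n a≤m
  m<a+N : m < a + N
  m<a+N = subst (_≤ a + N) (+-comm m 1) (m≤o∸n⇒m+n≤o m (≤-trans 1≤a (m≤m+n a N)) m≤top)
  a+j<a+N : a + (m ∸ a) < a + N
  a+j<a+N = subst (_< a + N) (sym a+j≡m) m<a+N

injection-onto : ∀ {N} (w : Fin N → ℕ) → (∀ x → w x < N) → (∀ {x y} → w x ≡ w y → x ≡ y) →
                 ∀ {y} → y < N → ∃ λ x → w x ≡ y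
injection-onto {zero} w _ _ ()
injection-onto {suc M} w w<N w-injective {y} y<N with any? (λ x → w x ≟ y)
... | yes hit = hit
... | no miss = contradiction (injective⇒≤ squeezed-injective) (<-irrefl refl)
  where
  -- If y were missed, removing y from the codomain would give an injection Fin (1 + M) → Fin M.
  target : Fin (suc M)
  target = fromℕ< y<N
  slot : Fin (suc M) → Fin (suc M)
  slot x = fromℕ< (w<N x)
  slot-value : ∀ x → toℕ (slot x) ≡ w x
  slot-value x = toℕ-fromℕ< (w<N x)
  target≢slot : ∀ x → target ≢ slot x
  target≢slot x eq = miss (x , trans (sym (slot-value x)) (trans (cong toℕ (sym eq)) (toℕ-fromℕ< y<N)))
  squeezed : Fin (suc M) → Fin M
  squeezed x = punchOut (target≢slot x)
  squeezed-injective : Injective _≡_ _≡_ squeezed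
  squeezed-injective {x} {x′} eq = w-injective (trans (sym (slot-value x))
    (trans (cong toℕ (punchOut-injective (target≢slot x) (target≢slot x′) eq)) (slot-value x′)))

member : (ℕ → ℕ) → ℕ → ℕ → Bool → ℕ
member first d i false = first i
member first d i true  = first i + (d + i)

-- A Langford pairing of defect d and order n: n pairs, the i-th with difference d + i, whose
-- 2n members are distinct numbers below 2n (so, by counting, they exhaust {0, …, 2n − 1}).
record LangfordPairing (d n : ℕ) : Set where
  field
    first    : ℕ → ℕ
    fits     : ∀ {i} → i < n → first i + (d + i) < n + n
    distinct : ∀ {i j b c} → i < n → j < n →
               member first d i b ≡ member first d j c → i ≡ j × b ≡ c

  position : ℕ → Bool → ℕ
  position = member first d

  position-fits : ∀ {i} b → i < n → position i b < n + n
  position-fits {i} false i<n = ≤-<-trans (m≤m+n (first i) (d + i)) (fits i<n)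
  position-fits     true  i<n = fits i<n

emptyPairing : ∀ d → LangfordPairing d 0
emptyPairing d = record { first = λ _ → 0 ; fits = λ () ; distinct = λ () }

-- Concatenation: a pairing of defect d and order m, followed by a pairing of defect d + m and
-- order n shifted up by 2m, is a pairing of defect d and order m + n.
module Concatenation {d m n} (S : LangfordPairing d m) (T : LangfordPairing (d + m) n) where
  private
    module S = LangfordPairing S
    module T = LangfordPairing T

  first : ℕ → ℕ
  first j with j <? m
  ... | yes _ = S.first j
  ... | no _  = (m + m) + T.first (j ∸ m)

  first-low : ∀ {j} → j < m → first j ≡ S.first j
  first-low {j} j<m with j <? m
  ... | yes _  = refl
  ... | no j≮m = contradiction j<m j≮m

  member-low : ∀ {j} b → j < m → member first d j b ≡ S.position j b
  member-low         false j<m = first-low j<m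
  member-low {j} true  j<m = cong (_+ (d + j)) (first-low j<m)

  first-high : ∀ t → first (m + t) ≡ (m + m) + T.first t
  first-high t with m + t <? m
  ... | yes m+t<m = contradiction (m≤m+n m t) (<⇒≱ m+t<m)
  ... | no _      = cong (λ s → (m + m) + T.first s) (m+n∸m≡n m t)

  -- Pair t of T has difference (d + m) + t, which is d + (m + t) as index m + t requires.
  member-high : ∀ t b → member first d (m + t) b ≡ (m + m) + T.position t b
  member-high t false = first-high t
  member-high t true  = begin
    first (m + t) + (d + (m + t))          ≡⟨ cong₂ _+_ (first-high t) (sym (+-assoc d m t)) ⟩
    (m + m) + T.first t + (d + m + t)      ≡⟨ +-assoc (m + m) (T.first t) (d + m + t) ⟩
    (m + m) + (T.first t + (d + m + t))    ∎
    where open ≡-Reasoning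

  low<high : ∀ {i} b t c → i < m → member first d i b < member first d (m + t) c
  low<high {i} b t c i<m = begin-strict
    member first d i b        ≡⟨ member-low b i<m ⟩
    S.position i b            <⟨ S.position-fits b i<m ⟩
    m + m                     ≤⟨ m≤m+n (m + m) (T.position t c) ⟩
    m + m + T.position t c    ≡⟨ sym (member-high t c) ⟩
    member first d (m + t) c  ∎
    where open ≤-Reasoning

  fits : ∀ {j} → j < m + n → first j + (d + j) < (m + n) + (m + n)
  fits j<m+n with cut m j<m+n
  ... | low j<m = begin-strict
    member first d _ true  ≡⟨ member-low true j<m ⟩
    S.position _ true      <⟨ S.fits j<m ⟩
    m + m                  ≤⟨ +-mono-≤ (m≤m+n m n) (m≤m+n m n) ⟩
    (m + n) + (m + n)      ∎
    where open ≤-Reasoning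
  ... | high {t} t<n = begin-strict
    member first d (m + t) true   ≡⟨ member-high t true ⟩
    (m + m) + T.position t true   <⟨ +-monoʳ-< (m + m) (T.fits t<n) ⟩
    (m + m) + (n + n)             ≡⟨ interchange m n ⟩
    (m + n) + (m + n)             ∎
    where
    open ≤-Reasoning
    interchange : ∀ m n → (m + m) + (n + n) ≡ (m + n) + (m + n)
    interchange = solve-∀

  distinct : ∀ {i j b c} → i < m + n → j < m + n →
             member first d i b ≡ member first d j c → i ≡ j × b ≡ c
  distinct {b = b} {c} i<m+n j<m+n eq with cut m i<m+n | cut m j<m+n
  ... | low i<m | low j<m =
    S.distinct i<m j<m (trans (sym (member-low b i<m)) (trans eq (member-low c j<m)))
  ... | low i<m | high {t} _ = contradiction eq (<⇒≢ (low<high b t c i<m))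
  ... | high {t} _ | low j<m = contradiction (sym eq) (<⇒≢ (low<high c t b j<m))
  ... | high {t} t<n | high {t′} t′<n with T.distinct t<n t′<n
        (+-cancelˡ-≡ (m + m) _ _ (trans (sym (member-high t b)) (trans eq (member-high t′ c))))
  ...   | t≡t′ , b≡c = cong (m +_) t≡t′ , b≡c

  pairing : LangfordPairing d (m + n)
  pairing = record { first = first ; fits = fits ; distinct = distinct }

-- In the tripling construction below, the pair with index 3q + ρ (ρ < 3) has its smaller member
-- in residue class digit false ρ and its larger member in residue class digit true ρ (mod 3).
digit : Bool → ℕ → ℕ
digit false 0 = 2
digit false 1 = 0
digit false _ = 1
digit true  0 = 1
digit true  1 = 0
digit true  _ = 2

digit<3 : ∀ b ρ → digit b ρ < 3
digit<3 false 0 = s≤s (s≤s (s≤s z≤n))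
digit<3 false 1 = s≤s z≤n
digit<3 false (suc (suc _)) = s≤s (s≤s z≤n)
digit<3 true  0 = s≤s (s≤s z≤n)
digit<3 true  1 = s≤s z≤n
digit<3 true  (suc (suc _)) = s≤s (s≤s (s≤s z≤n))

undigit : Bool → ℕ → ℕ
undigit false 2 = 0
undigit false 0 = 1
undigit false _ = 2
undigit true  1 = 0
undigit true  0 = 1
undigit true  _ = 2

undigit-digit : ∀ b {ρ} → ρ < 3 → undigit b (digit b ρ) ≡ ρ
undigit-digit false {0} _ = refl
undigit-digit false {1} _ = refl
undigit-digit false {2} _ = refl
undigit-digit true  {0} _ = refl
undigit-digit true  {1} _ = refl
undigit-digit true  {2} _ = refl
undigit-digit _ {suc (suc (suc _))} (s≤s (s≤s (s≤s ())))

digit-injective : ∀ b {ρ σ} → ρ < 3 → σ < 3 → digit b ρ ≡ digit b σ → ρ ≡ σ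
digit-injective b ρ<3 σ<3 eq =
  trans (sym (undigit-digit b ρ<3)) (trans (cong (undigit b) eq) (undigit-digit b σ<3))

-- The digits are chosen so that, if a pair {x, x + (e + 1 + q)} is blown up, the pair
-- {3x + digit false ρ, 3(x + e + 1 + q) + digit true ρ} has difference (3e + 2) + (3q + ρ).
tripled-difference : ∀ {ρ} → ρ < 3 → ∀ e q x →
  digit false ρ + x * 3 + (suc (suc (e * 3)) + (ρ + q * 3)) ≡ digit true ρ + (x + (suc e + q)) * 3
tripled-difference {0} _ = solve-∀
tripled-difference {1} _ = solve-∀
tripled-difference {2} _ = solve-∀
tripled-difference {suc (suc (suc _))} (s≤s (s≤s (s≤s ())))

-- Tripling: from a pairing of defect e + 1 and order n, replacing each position x by the three
-- positions 3x, 3x + 1, 3x + 2 gives a pairing of defect 3e + 2 and order 3n; pair q becomes the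
-- pairs 3q, 3q + 1, 3q + 2, placed in the residue classes prescribed by digit.
module Tripling {e n} (P : LangfordPairing (suc e) n) where
  private
    module P = LangfordPairing P

  -- 3(e + 1) − 1
  defect : ℕ
  defect = suc (suc (e * 3))

  first : ℕ → ℕ
  first j = digit false (j % 3) + P.first (j / 3) * 3

  member-digits : ∀ {ρ} q b → ρ < 3 → member first defect (ρ + q * 3) b ≡ digit b ρ + P.position q b * 3
  member-digits {ρ} q false ρ<3 =
    cong₂ (λ r s → digit false r + P.first s * 3) (digit-remainder q ρ<3) (digit-quotient q ρ<3)
  member-digits {ρ} q true ρ<3 = begin
    first (ρ + q * 3) + (defect + (ρ + q * 3))
      ≡⟨ cong (_+ (defect + (ρ + q * 3))) (member-digits q false ρ<3) ⟩
    digit false ρ + P.first q * 3 + (defect + (ρ + q * 3))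
      ≡⟨ tripled-difference ρ<3 e q (P.first q) ⟩
    digit true ρ + P.position q true * 3 ∎
    where open ≡-Reasoning

  fits : ∀ {j} → j < n * 3 → first j + (defect + j) < n * 3 + n * 3
  fits {j} j<3n with digitsOf 3 j
  ... | digits ρ q ρ<3 = begin-strict
    member first defect (ρ + q * 3) true  ≡⟨ member-digits q true ρ<3 ⟩
    digit true ρ + P.position q true * 3  <⟨ digits-< (digit<3 true ρ) (P.fits (digits-<⁻¹ j<3n)) ⟩
    (n + n) * 3                           ≡⟨ *-distribʳ-+ 3 n n ⟩
    n * 3 + n * 3                         ∎
    where open ≤-Reasoning

  collapse : ∀ {ρ σ q q′ b c} → ρ < 3 → σ < 3 → q < n → q′ < n →
             digit b ρ + P.position q b * 3 ≡ digit c σ + P.position q′ c * 3 →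
             ρ + q * 3 ≡ σ + q′ * 3 × b ≡ c
  collapse {ρ} {σ} {q} {b = b} {c} ρ<3 σ<3 q<n q′<n eq
    with digits-unique (digit<3 b ρ) (digit<3 c σ) eq
  ... | same-digit , same-member with P.distinct {b = b} {c} q<n q′<n same-member
  ...   | refl , refl = cong (_+ q * 3) (digit-injective b ρ<3 σ<3 same-digit) , refl

  distinct : ∀ {i j b c} → i < n * 3 → j < n * 3 →
             member first defect i b ≡ member first defect j c → i ≡ j × b ≡ c
  distinct {i} {j} {b} {c} i<3n j<3n eq with digitsOf 3 i | digitsOf 3 j
  ... | digits ρ q ρ<3 | digits σ q′ σ<3 =
    collapse ρ<3 σ<3 (digits-<⁻¹ i<3n) (digits-<⁻¹ j<3n)
      (trans (sym (member-digits q b ρ<3)) (trans eq (member-digits q′ c σ<3)))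

  pairing : LangfordPairing defect (n * 3)
  pairing = record { first = first ; fits = fits ; distinct = distinct }

-- The base pairing has defect e + 1 and order 2e + 1. Writing t = e − 1 − i for i < e and
-- t = 2e − i for e ≤ i ≤ 2e, its i-th pair is
--   {1 + 2t, (2e + 1) + t}  if i < e,     {2t, (3e + 1) + t}  if e ≤ i ≤ 2e,
-- so the smaller members are 0, …, 2e and the larger ones 2e + 1, …, 4e + 1.
baseFirst : ℕ → ℕ → ℕ
baseFirst e i with i <? e
... | yes _ = 1 + (e ∸ suc i) * 2
... | no _  = (e + e ∸ i) * 2

-- The two kinds of indices i < 2e + 1, with e and i expressed through t.
data BaseIndex : ℕ → ℕ → Set where
  short : ∀ i t → BaseIndex (suc (i + t)) i
  long  : ∀ s t → BaseIndex (s + t) (s + t + s)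

baseIndex : ∀ e {i} → i < suc (e + e) → BaseIndex e i
baseIndex e {i} i<2e+1 with i <? e
... | yes i<e = subst (λ e′ → BaseIndex e′ i) (m+[n∸m]≡n i<e) (short i (e ∸ suc i))
... | no i≮e  = subst (BaseIndex e) (m+[n∸m]≡n e≤i)
                  (subst (λ e′ → BaseIndex e′ (e′ + s)) (m+[n∸m]≡n s≤e) (long s (e ∸ s)))
  where
  e≤i : e ≤ i
  e≤i = ≮⇒≥ i≮e
  s : ℕ
  s = i ∸ e
  s≤e : s ≤ e
  s≤e = m≤n+o⇒m∸n≤o i e (s≤s⁻¹ i<2e+1)

closedMember : ∀ {e i} → BaseIndex e i → Bool → ℕ
closedMember (short i t) false = 1 + t * 2
closedMember (short i t) true  = let e = suc (i + t) in suc (e + e) + t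
closedMember (long s t)  false = t * 2
closedMember (long s t)  true  = let e = s + t in suc (e + e + e) + t

baseFirst-short : ∀ i t → baseFirst (suc (i + t)) i ≡ 1 + t * 2
baseFirst-short i t with i <? suc (i + t)
... | yes _  = cong (λ u → 1 + u * 2) (m+n∸m≡n i t)
... | no i≮e = contradiction (s≤s (m≤m+n i t)) i≮e

baseFirst-long : ∀ s t → baseFirst (s + t) (s + t + s) ≡ t * 2
baseFirst-long s t with s + t + s <? s + t
... | yes i<e = contradiction (m≤m+n (s + t) s) (<⇒≱ i<e)
... | no _    = cong (_* 2) (trans ([m+n]∸[m+o]≡n∸o (s + t) (s + t) s) (m+n∸m≡n s t))

base-member : ∀ {e i} (ix : BaseIndex e i) b → member (baseFirst e) (suc e) i b ≡ closedMember ix b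
base-member (short i t) false = baseFirst-short i t
base-member (short i t) true  =
  trans (cong (_+ (suc (suc (i + t)) + i)) (baseFirst-short i t)) (difference i t)
  where
  difference : ∀ i t → 1 + t * 2 + (suc (suc (i + t)) + i) ≡ suc (suc (i + t) + suc (i + t)) + t
  difference = solve-∀
base-member (long s t) false = baseFirst-long s t
base-member (long s t) true  =
  trans (cong (_+ (suc (s + t) + (s + t + s))) (baseFirst-long s t)) (difference s t)
  where
  difference : ∀ s t → t * 2 + (suc (s + t) + (s + t + s)) ≡ suc ((s + t) + (s + t) + (s + t)) + t
  difference = solve-∀

closed-fits : ∀ {e i} (ix : BaseIndex e i) → closedMember ix true < suc (e + e) + suc (e + e)
closed-fits (short i t) = +-monoʳ-< (suc (e + e)) (s≤s t≤2e)
  where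
  e : ℕ
  e = suc (i + t)
  t≤2e : t ≤ e + e
  t≤2e = ≤-trans (m≤n+m t i) (≤-trans (n≤1+n (i + t)) (m≤m+n e e))
closed-fits (long s t) = begin-strict
  suc (e + e + e) + t      ≤⟨ +-monoʳ-≤ (suc (e + e + e)) (m≤n+m t s) ⟩
  suc (e + e + e) + e      <⟨ n<1+n _ ⟩
  suc (suc (e + e + e) + e) ≡⟨ twice e ⟩
  suc (e + e) + suc (e + e) ∎
  where
  open ≤-Reasoning
  e : ℕ
  e = s + t
  twice : ∀ e → suc (suc (e + e + e) + e) ≡ suc (e + e) + suc (e + e)
  twice = solve-∀

-- Decoding the base pairing: smaller members are the numbers ≤ 2e, and their parity tells the
-- kind of index; larger members are (2e + 1) + t for short and (3e + 1) + t for long indices.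
smallerIndex : ℕ → ℕ → ℕ → ℕ
smallerIndex e zero    t = e + e ∸ t
smallerIndex e (suc _) t = e ∸ suc t

baseDecode : ℕ → ℕ → ℕ × Bool
baseDecode e x with x <? suc (e + e) | x <? suc (e + e + e)
... | yes _ | _     = smallerIndex e (x % 2) (x / 2) , false
... | no _  | yes _ = e ∸ suc (x ∸ suc (e + e)) , true
... | no _  | no _  = e + e ∸ (x ∸ suc (e + e + e)) , true

decode-smaller : ∀ {e x} → x < suc (e + e) → baseDecode e x ≡ (smallerIndex e (x % 2) (x / 2) , false)
decode-smaller {e} {x} x<2e+1 with x <? suc (e + e) | x <? suc (e + e + e)
... | yes _ | _  = refl
... | no x≮ | _  = contradiction x<2e+1 x≮

decode-middle : ∀ {e x} → suc (e + e) ≤ x → x < suc (e + e + e) →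
                baseDecode e x ≡ (e ∸ suc (x ∸ suc (e + e)) , true)
decode-middle {e} {x} lower upper with x <? suc (e + e) | x <? suc (e + e + e)
... | yes x< | _     = contradiction lower (<⇒≱ x<)
... | no _   | yes _ = refl
... | no _   | no x≮ = contradiction upper x≮

decode-top : ∀ {e x} → suc (e + e + e) ≤ x → baseDecode e x ≡ (e + e ∸ (x ∸ suc (e + e + e)) , true)
decode-top {e} {x} lower with x <? suc (e + e) | x <? suc (e + e + e)
... | yes x< | _     = contradiction (≤-trans (s≤s (m≤m+n (e + e) e)) lower) (<⇒≱ x<)
... | no _   | yes x< = contradiction lower (<⇒≱ x<)
... | no _   | no _  = refl

double : ∀ e → e * 2 ≡ e + e
double = solve-∀

long-index : ∀ s t → (s + t) + (s + t) ∸ t ≡ s + t + s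
long-index s t = trans (cong (_∸ t) (regroup s t)) (m+n∸n≡m (s + t + s) t)
  where
  regroup : ∀ s t → (s + t) + (s + t) ≡ (s + t + s) + t
  regroup = solve-∀

-- baseDecode inverts the closed form, hence the base pairing: its members are distinct.
decode-closed : ∀ {e i} (ix : BaseIndex e i) b → baseDecode e (closedMember ix b) ≡ (i , b)
decode-closed (short i t) false = begin
  baseDecode e (1 + t * 2)
    ≡⟨ decode-smaller (<-≤-trans (digits-< (n<1+n 1) t<e) (≤-trans (≤-reflexive (double e)) (n≤1+n _))) ⟩
  smallerIndex e ((1 + t * 2) % 2) ((1 + t * 2) / 2) , false
    ≡⟨ cong₂ (λ r q → smallerIndex e r q , false) (digit-remainder t (n<1+n 1)) (digit-quotient t (n<1+n 1)) ⟩
  e ∸ suc t , false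
    ≡⟨ cong (_, false) (m+n∸n≡m i t) ⟩
  i , false ∎
  where
  open ≡-Reasoning
  e : ℕ
  e = suc (i + t)
  t<e : t < e
  t<e = s≤s (m≤n+m t i)
decode-closed (short i t) true = begin
  baseDecode e (suc (e + e) + t)
    ≡⟨ decode-middle (m≤m+n (suc (e + e)) t) (s≤s (+-monoʳ-< (e + e) (s≤s (m≤n+m t i)))) ⟩
  e ∸ suc (suc (e + e) + t ∸ suc (e + e)) , true
    ≡⟨ cong (λ u → e ∸ suc u , true) (m+n∸m≡n (suc (e + e)) t) ⟩
  e ∸ suc t , true
    ≡⟨ cong (_, true) (m+n∸n≡m i t) ⟩
  i , true ∎
  where
  open ≡-Reasoning
  e : ℕ
  e = suc (i + t)
decode-closed (long s t) false = begin
  baseDecode e (t * 2)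
    ≡⟨ decode-smaller (s≤s (subst (t * 2 ≤_) (double e) (*-monoˡ-≤ 2 (m≤n+m t s)))) ⟩
  smallerIndex e ((t * 2) % 2) ((t * 2) / 2) , false
    ≡⟨ cong₂ (λ r q → smallerIndex e r q , false) (digit-remainder t (s≤s z≤n)) (digit-quotient t (s≤s z≤n)) ⟩
  e + e ∸ t , false
    ≡⟨ cong (_, false) (long-index s t) ⟩
  e + s , false ∎
  where
  open ≡-Reasoning
  e : ℕ
  e = s + t
decode-closed (long s t) true = begin
  baseDecode e (suc (e + e + e) + t)
    ≡⟨ decode-top (m≤m+n (suc (e + e + e)) t) ⟩
  e + e ∸ (suc (e + e + e) + t ∸ suc (e + e + e)) , true
    ≡⟨ cong (λ u → e + e ∸ u , true) (m+n∸m≡n (suc (e + e + e)) t) ⟩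
  e + e ∸ t , true
    ≡⟨ cong (_, true) (long-index s t) ⟩
  e + s , true ∎
  where
  open ≡-Reasoning
  e : ℕ
  e = s + t

decode-member : ∀ {e i} (ix : BaseIndex e i) b → baseDecode e (member (baseFirst e) (suc e) i b) ≡ (i , b)
decode-member ix b = trans (cong (baseDecode _) (base-member ix b)) (decode-closed ix b)

basePairing : ∀ e → LangfordPairing (suc e) (suc (e + e))
basePairing e = record
  { first    = baseFirst e
  ; fits     = λ i< → subst (_< _) (sym (base-member (baseIndex e i<) true)) (closed-fits (baseIndex e i<))
  ; distinct = distinct
  }
  where
  distinct : ∀ {i j b c} → i < suc (e + e) → j < suc (e + e) →
             member (baseFirst e) (suc e) i b ≡ member (baseFirst e) (suc e) j c → i ≡ j × b ≡ c
  distinct {i} {j} {b} {c} i< j< eq = ,-injectiveˡ same , ,-injectiveʳ same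
    where
    same : (i , b) ≡ (j , c)
    same = trans (sym (decode-member (baseIndex e i<) b))
                 (trans (cong (baseDecode e) eq) (decode-member (baseIndex e j<) c))

EdgeIntervalLabeling : ℕ → ℕ → Set
EdgeIntervalLabeling k n = Σ (Fin (p (nK₂ n)) ⊎ Fin (q (nK₂ n)) → ℕ)
  (λ f → SuperGraceful k (nK₂ n) f × EdgeLabelSet (nK₂ n) f k (k + n ∸ 1))

module Labeling {k n} (1≤k : 1 ≤ k) (L : LangfordPairing k n) where
  private
    module L = LangfordPairing L

  -- Vertex i ↑ˡ n is the smaller and vertex n ↑ʳ i the larger end of edge i.
  endPosition : Fin n ⊎ Fin n → ℕ
  endPosition (inj₁ i) = L.position (toℕ i) false
  endPosition (inj₂ i) = L.position (toℕ i) true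

  endPosition-fits : ∀ x → endPosition x < n + n
  endPosition-fits (inj₁ i) = L.position-fits false (toℕ<n i)
  endPosition-fits (inj₂ i) = L.position-fits true (toℕ<n i)

  endPosition-injective : ∀ x y → endPosition x ≡ endPosition y → x ≡ y
  endPosition-injective (inj₁ i) (inj₁ j) eq =
    cong inj₁ (toℕ-injective (proj₁ (L.distinct {b = false} {false} (toℕ<n i) (toℕ<n j) eq)))
  endPosition-injective (inj₁ i) (inj₂ j) eq =
    contradiction (proj₂ (L.distinct {b = false} {true} (toℕ<n i) (toℕ<n j) eq)) λ ()
  endPosition-injective (inj₂ i) (inj₁ j) eq =
    contradiction (proj₂ (L.distinct {b = true} {false} (toℕ<n i) (toℕ<n j) eq)) λ ()
  endPosition-injective (inj₂ i) (inj₂ j) eq =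
    cong inj₂ (toℕ-injective (proj₁ (L.distinct {b = true} {true} (toℕ<n i) (toℕ<n j) eq)))

  vertexPosition : Fin (n + n) → ℕ
  vertexPosition v = endPosition (splitAt n v)

  vertexPosition-fits : ∀ v → vertexPosition v < n + n
  vertexPosition-fits v = endPosition-fits (splitAt n v)

  vertexPosition-injective : ∀ {v w} → vertexPosition v ≡ vertexPosition w → v ≡ w
  vertexPosition-injective {v} {w} eq = begin
    v                      ≡⟨ join-splitAt n n v ⟨
    join n n (splitAt n v) ≡⟨ cong (join n n) (endPosition-injective (splitAt n v) (splitAt n w) eq) ⟩
    join n n (splitAt n w) ≡⟨ join-splitAt n n w ⟩
    w                      ∎
    where open ≡-Reasoning

  offset : Fin (n + n) ⊎ Fin n → ℕ
  offset (inj₁ v) = n + vertexPosition v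
  offset (inj₂ i) = toℕ i

  label : Fin (n + n) ⊎ Fin n → ℕ
  label z = k + offset z

  offset-fits : ∀ z → offset z < n + (n + n)
  offset-fits (inj₁ v) = +-monoʳ-< n (vertexPosition-fits v)
  offset-fits (inj₂ i) = <-≤-trans (toℕ<n i) (m≤m+n n (n + n))

  edge<vertex : ∀ i v → offset (inj₂ i) < offset (inj₁ v)
  edge<vertex i v = <-≤-trans (toℕ<n i) (m≤m+n n (vertexPosition v))

  offset-injective : ∀ z z′ → offset z ≡ offset z′ → z ≡ z′
  offset-injective (inj₁ v) (inj₁ w) eq = cong inj₁ (vertexPosition-injective (+-cancelˡ-≡ n _ _ eq))
  offset-injective (inj₁ v) (inj₂ j) eq = contradiction (sym eq) (<⇒≢ (edge<vertex j v))
  offset-injective (inj₂ i) (inj₁ w) eq = contradiction eq (<⇒≢ (edge<vertex i w))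
  offset-injective (inj₂ i) (inj₂ j) eq = cong inj₂ (toℕ-injective eq)

  -- Every offset below 3n is taken; for vertices this is the pigeonhole principle.
  offset-onto : ∀ {j} → j < n + (n + n) → ∃ λ z → offset z ≡ j
  offset-onto j<3n with cut n j<3n
  ... | low j<n = inj₂ (fromℕ< j<n) , toℕ-fromℕ< j<n
  ... | high w<2n with injection-onto vertexPosition vertexPosition-fits vertexPosition-injective w<2n
  ...   | v , vertexPosition≡w = inj₁ v , cong (n +_) vertexPosition≡w

  total : k + (n + n) + n ≡ k + (n + (n + n))
  total = trans (+-assoc k (n + n) n) (cong (k +_) (+-comm (n + n) n))

  into : ∀ z → InRange k (k + (n + n) + n ∸ 1) (label z)
  into z = subst (λ top → InRange k (top ∸ 1) (label z)) (sym total) (offset∈range (offset-fits z))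

  onto : ∀ m → InRange k (k + (n + n) + n ∸ 1) m → ∃ λ z → label z ≡ m
  onto m m∈range with range⇒offset 1≤k (subst (λ top → InRange k (top ∸ 1) m) total m∈range)
  ... | j , j<3n , k+j≡m with offset-onto j<3n
  ...   | z , offset≡j = z , trans (cong (k +_) offset≡j) k+j≡m

  -- The ends of edge i carry k + n + x and k + n + x + (k + i), with x the smaller member of pair i.
  edgeLabel : ∀ i → label (inj₂ i) ≡ ∣ label (inj₁ (i ↑ˡ n)) - label (inj₁ (n ↑ʳ i)) ∣
  edgeLabel i = begin
    k + toℕ i
      ≡⟨ ∣m-m+n∣≡n (k + (n + x)) (k + toℕ i) ⟨
    ∣ k + (n + x) - k + (n + x) + (k + toℕ i) ∣
      ≡⟨ cong (λ y → ∣ k + (n + x) - y ∣) (regroup k n x (k + toℕ i)) ⟩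
    ∣ k + (n + x) - k + (n + (x + (k + toℕ i))) ∣
      ≡⟨ cong₂ (λ y y′ → ∣ k + (n + y) - k + (n + y′) ∣) (cong endPosition (splitAt-↑ˡ n i n))
                                                         (cong endPosition (splitAt-↑ʳ n n i)) ⟨
    ∣ label (inj₁ (i ↑ˡ n)) - label (inj₁ (n ↑ʳ i)) ∣ ∎
    where
    open ≡-Reasoning
    x : ℕ
    x = L.first (toℕ i)
    regroup : ∀ k n x y → k + (n + x) + y ≡ k + (n + (x + y))
    regroup = solve-∀

  edgeLabels : EdgeLabelSet (nK₂ n) label k (k + n ∸ 1)
  edgeLabels m = (λ { (i , refl) → offset∈range (toℕ<n i) }) , λ m∈range →
    let j , j<n , k+j≡m = range⇒offset 1≤k m∈range
    in fromℕ< j<n , trans (cong (k +_) (toℕ-fromℕ< j<n)) k+j≡m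

  labeling : EdgeIntervalLabeling k n
  labeling = label , record
    { injective = λ z z′ eq → offset-injective z z′ (+-cancelˡ-≡ k _ _ eq)
    ; into      = into
    ; onto      = onto
    ; edgeLabel = edgeLabel
    } , edgeLabels

order : ℕ → ℕ → ℕ
order e zero    = 0
order e (suc r) = suc (e + e) + order e r * 3

langford : ∀ e r → LangfordPairing (suc e) (order e r)
langford e zero    = emptyPairing (suc e)
langford e (suc r) = Concatenation.pairing (basePairing e)
  (subst (λ d → LangfordPairing d (order e r * 3)) (tripled-defect e) (Tripling.pairing (langford e r)))
  where
  -- The tripled defect 3(e + 1) − 1 is (e + 1) + (2e + 1), as concatenation requires.
  tripled-defect : ∀ e → suc (suc (e * 3)) ≡ suc e + suc (e + e)
  tripled-defect = solve-∀

twice-order : ∀ e r → order e r * 2 + suc (e + e) ≡ suc (e + e) * 3 ^ r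
twice-order e zero    = sym (*-identityʳ (suc (e + e)))
twice-order e (suc r) = begin
  (c + order e r * 3) * 2 + c  ≡⟨ regroup c (order e r) ⟩
  (order e r * 2 + c) * 3      ≡⟨ cong (_* 3) (twice-order e r) ⟩
  c * 3 ^ r * 3                ≡⟨ reassociate c (3 ^ r) ⟩
  c * 3 ^ suc r                ∎
  where
  open ≡-Reasoning
  c : ℕ
  c = suc (e + e)
  regroup : ∀ c o → (c + o * 3) * 2 + c ≡ (o * 2 + c) * 3
  regroup = solve-∀
  reassociate : ∀ c x → c * x * 3 ≡ c * (3 * x)
  reassociate = solve-∀

order-formula : ∀ e r → ((2 * suc e ∸ 1) * (3 ^ r ∸ 1)) / 2 ≡ order e r
order-formula e r = begin
  ((2 * suc e ∸ 1) * (3 ^ r ∸ 1)) / 2  ≡⟨ cong (λ u → u * (3 ^ r ∸ 1) / 2) odd-factor ⟩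
  c * (3 ^ r ∸ 1) / 2                  ≡⟨ cong (_/ 2) (*-distribˡ-∸ c (3 ^ r) 1) ⟩
  (c * 3 ^ r ∸ c * 1) / 2              ≡⟨ cong₂ (λ u v → (u ∸ v) / 2) (sym (twice-order e r)) (*-identityʳ c) ⟩
  (order e r * 2 + c ∸ c) / 2          ≡⟨ cong (_/ 2) (m+n∸n≡m (order e r * 2) c) ⟩
  order e r * 2 / 2                    ≡⟨ m*n/n≡m (order e r) 2 ⟩
  order e r                            ∎
  where
  open ≡-Reasoning
  c : ℕ
  c = suc (e + e)
  odd-factor : 2 * suc e ∸ 1 ≡ c
  odd-factor = trans (+-suc e (e + 0)) (cong (λ u → suc (e + u)) (+-identityʳ e))

-- For k = e + 1 the pairing langford e r gives the labeling.
corollary3p16 : (k r : ℕ) → 1 ≤ k → 1 ≤ r →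
    let n = ((2 * k ∸ 1) * (3 ^ r ∸ 1)) / 2 in
    Σ (Fin (p (nK₂ n)) ⊎ Fin (q (nK₂ n)) → ℕ)
      (λ f → SuperGraceful k (nK₂ n) f × EdgeLabelSet (nK₂ n) f k (k + n ∸ 1))
corollary3p16 zero    _ ()  _
corollary3p16 (suc e) r 1≤k _ =
  subst (EdgeIntervalLabeling (suc e)) (sym (order-formula e r)) (Labeling.labeling 1≤k (langford e r))
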